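{- Let $(p_i/q_i)_{i\in\mathbb{Z}}$ and $(r_j/s_j)_{j\in\mathbb{Z}}$ be two bi-infinite normalised paths in $\mathcal{T}$. Then their scalar product, the matrix $(m_{i,j})_{i,j\in\mathbb{Z}}$ with $m_{i,j}=p_ir_j+q_is_j$, is a tame $SL_2(\mathbb{Z}[\sigma])$-tiling.
   Context: Let $\sigma=e^{i\pi/3}$, $\mathbb{Z}[\sigma]$ the Eisenstein integers, $\widehat{\mathbb{Q}}(\sigma)=\mathbb{Q}(\sigma)\cup\{\infty\}$. A fraction $p/q$ ($p,q\in\mathbb{Z}[\sigma]$, not both zero) is irreducible if every common factor $k\in\mathbb{Z}[\sigma]$ of $p,q$ has $|k|=1$. Let $\mathcal{T}$ be the graph with vertex set $\widehat{\mathbb{Q}}(\sigma)$ in which points with irreducible representations $p/q$, $r/s$ are joined by an edge iff $|ps-rq|=1$ (these are exactly the edges of the tiling of $\mathbb{H}^3$ by the images of the regular ideal tetrahedron with vertices $0,1,\sigma,\infty$ under its reflection group). A bi-infinite path is a sequence $(v_i)_{i\in\mathbb{Z}}$ of vertices with $v_iv_{i+1}$ an edge for all $i$; it is normalised if it is given by irreducible fractions $v_i=p_i/q_i$ with $p_iq_{i+1}-p_{i+1}q_i=1$ for all $i$. A bi-infinite matrix $M=(m_{i,j})_{i,j\in\mathbb{Z}}$ with entries in $\mathbb{Z}[\sigma]$ is an $SL_2(\mathbb{Z}[\sigma])$-tiling if $m_{i,j}m_{i+1,j+1}-m_{i,j+1}m_{i+1,j}=1$ for all $i,j$; it is tame if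 every $3\times3$ matrix $(m_{i+a,j+b})_{a,b=0,1,2}$ of adjacent entries has determinant $0$. -}

module Defs where

open import Data.Integer as ℤ using (ℤ; 0ℤ; 1ℤ)
open import Data.Product using (Σ; ∃; _×_; _,_)
open import Relation.Binary.PropositionalEquality using (_≡_)
open import Relation.Nullary using (¬_)

-- Eisenstein integers ℤ[σ], σ = e^{iπ/3}, represented uniquely as a + bσ
-- with a b ∈ ℤ.  σ satisfies σ² = σ - 1.
record 𝔼 : Set where
  constructor _+_σ
  field
    re : ℤ
    im : ℤ
open 𝔼 public

infixl 6 _+ᴱ_ _-ᴱ_
infixl 7 _*ᴱ_

0ᴱ : 𝔼
0ᴱ = 0ℤ + 0ℤ σ

1ᴱ : 𝔼
1ᴱ = 1ℤ + 0ℤ σ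

_+ᴱ_ : 𝔼 → 𝔼 → 𝔼
(a + b σ) +ᴱ (c + d σ) = (a ℤ.+ c) + (b ℤ.+ d) σ

-ᴱ_ : 𝔼 → 𝔼
-ᴱ (a + b σ) = (ℤ.- a) + (ℤ.- b) σ

_-ᴱ_ : 𝔼 → 𝔼 → 𝔼
x -ᴱ y = x +ᴱ (-ᴱ y)

-- (a + bσ)(c + dσ) = ac + (ad + bc)σ + bd σ² = (ac - bd) + (ad + bc + bd)σ
_*ᴱ_ : 𝔼 → 𝔼 → 𝔼
(a + b σ) *ᴱ (c + d σ) =
  (a ℤ.* c ℤ.- b ℤ.* d) + (a ℤ.* d ℤ.+ b ℤ.* c ℤ.+ b ℤ.* d) σ

-- |a + bσ|² = a² + ab + b²  (so |k| = 1 iff normSq k ≡ 1)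
normSq : 𝔼 → ℤ
normSq (a + b σ) = a ℤ.* a ℤ.+ a ℤ.* b ℤ.+ b ℤ.* b

_∣ᴱ_ : 𝔼 → 𝔼 → Set
k ∣ᴱ p = ∃ λ c → k *ᴱ c ≡ p

Irreducible : 𝔼 → 𝔼 → Set
Irreducible p q =
  ¬ (p ≡ 0ᴱ × q ≡ 0ᴱ) ×
  (∀ k → k ∣ᴱ p → k ∣ᴱ q → normSq k ≡ 1ℤ)

-- Edge of 𝒯 between p/q and r/s (irreducible representations): |ps - rq| = 1
Edge : 𝔼 → 𝔼 → 𝔼 → 𝔼 → Set
Edge p q r s = normSq (p *ᴱ s -ᴱ r *ᴱ q) ≡ 1ℤ

NormalisedPath : (ℤ → 𝔼) → (ℤ → 𝔼) → Set
NormalisedPath p q =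
  (∀ i → Irreducible (p i) (q i)) ×
  (∀ i → Edge (p i) (q i) (p (ℤ.suc i)) (q (ℤ.suc i))) ×
  (∀ i → p i *ᴱ q (ℤ.suc i) -ᴱ p (ℤ.suc i) *ᴱ q i ≡ 1ᴱ)

Matrix : Set
Matrix = ℤ → ℤ → 𝔼

IsSL2Tiling : Matrix → Set
IsSL2Tiling m = ∀ i j →
  m i j *ᴱ m (ℤ.suc i) (ℤ.suc j) -ᴱ m i (ℤ.suc j) *ᴱ m (ℤ.suc i) j ≡ 1ᴱ

det3 : 𝔼 → 𝔼 → 𝔼 → 𝔼 → 𝔼 → 𝔼 → 𝔼 → 𝔼 → 𝔼 → 𝔼
det3 a b c d e f g h k =
  a *ᴱ (e *ᴱ k -ᴱ f *ᴱ h) -ᴱ b *ᴱ (d *ᴱ k -ᴱ f *ᴱ g) +ᴱ c *ᴱ (d *ᴱ h -ᴱ e *ᴱ g)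

IsTame : Matrix → Set
IsTame m = ∀ i j →
  let i₁ = ℤ.suc i ; i₂ = ℤ.suc (ℤ.suc i)
      j₁ = ℤ.suc j ; j₂ = ℤ.suc (ℤ.suc j)
  in det3 (m i j)  (m i j₁)  (m i j₂)
          (m i₁ j) (m i₁ j₁) (m i₁ j₂)
          (m i₂ j) (m i₂ j₁) (m i₂ j₂) ≡ 0ᴱ

scalarProduct : (ℤ → 𝔼) → (ℤ → 𝔼) → (ℤ → 𝔼) → (ℤ → 𝔼) → Matrix
scalarProduct p q r s i j = p i *ᴱ r j +ᴱ q i *ᴱ s j

-- Write u_i = (p_i, q_i) and v_j = (r_j, s_j), so m_{i,j} = ⟨u_i, v_j⟩ and every
-- block of adjacent entries of m is a product of a matrix with rows u_i and a
-- matrix with columns v_j.  A 2×2 block is then the product of two 2×2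
-- matrices, whose determinants are 1 by normalisation, so by multiplicativity
-- of det it has determinant 1.  A 3×3 block factors through ℤ[σ]², so it has
-- rank at most 2 and determinant 0.  Both are polynomial identities over the
-- commutative ring ℤ[σ].
module Submission where

open import Defs
open import Algebra.Bundles using (CommutativeRing)
open import Algebra.Consequences.Propositional
  using (comm∧idˡ⇒id; comm∧invˡ⇒inv; comm∧distrʳ⇒distrˡ)
open import Algebra.Structures using (IsCommutativeRing)
open import Data.Integer as ℤ using (ℤ; _*_; _-_; _+_)
import Data.Integer.Properties as ℤ
import Data.Integer.Tactic.RingSolver as ℤ-Solver
open import Data.List using (_∷_; [])
open import Data.Maybe using (Maybe; just; nothing)
open import Data.Product using (_×_; _,_)
open import Relation.Binary.PropositionalEquality
open import Relation.Nullary using (yes; no)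
open import Tactic.RingSolver.Core.AlmostCommutativeRing
  using (AlmostCommutativeRing; fromCommutativeRing)

open import Algebra.Definitions {A = 𝔼} _≡_

+ᴱ-assoc : Associative _+ᴱ_
+ᴱ-assoc (a + b σ) (c + d σ) (e + f σ) = cong₂ _+_σ (ℤ.+-assoc a c e) (ℤ.+-assoc b d f)

+ᴱ-comm : Commutative _+ᴱ_
+ᴱ-comm (a + b σ) (c + d σ) = cong₂ _+_σ (ℤ.+-comm a c) (ℤ.+-comm b d)

+ᴱ-identityˡ : LeftIdentity 0ᴱ _+ᴱ_
+ᴱ-identityˡ (a + b σ) = cong₂ _+_σ (ℤ.+-identityˡ a) (ℤ.+-identityˡ b)

+ᴱ-inverseˡ : LeftInverse 0ᴱ (-ᴱ_) _+ᴱ_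
+ᴱ-inverseˡ (a + b σ) = cong₂ _+_σ (ℤ.+-inverseˡ a) (ℤ.+-inverseˡ b)

-- Nested products leave stuck projections re/im in the goal, which the
-- reflective solver would treat as atoms; hence the explicit components.
*ᴱ-assoc : Associative _*ᴱ_
*ᴱ-assoc (a + b σ) (c + d σ) (e + f σ) =
  cong₂ _+_σ (re-assoc a b c d e f) (im-assoc a b c d e f)
  where
  re-assoc : ∀ a b c d e f →
    (a * c - b * d) * e - (a * d + b * c + b * d) * f ≡
    a * (c * e - d * f) - b * (c * f + d * e + d * f)
  re-assoc = ℤ-Solver.solve-∀

  im-assoc : ∀ a b c d e f →
    (a * c - b * d) * f + (a * d + b * c + b * d) * e + (a * d + b * c + b * d) * f ≡
    a * (c * f + d * e + d * f) + b * (c * e - d * f) + b * (c * f + d * e + d * f)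
  im-assoc = ℤ-Solver.solve-∀

*ᴱ-comm : Commutative _*ᴱ_
*ᴱ-comm (a + b σ) (c + d σ) =
  cong₂ _+_σ (ℤ-Solver.solve (a ∷ b ∷ c ∷ d ∷ [])) (ℤ-Solver.solve (a ∷ b ∷ c ∷ d ∷ []))

*ᴱ-identityˡ : LeftIdentity 1ᴱ _*ᴱ_
*ᴱ-identityˡ (a + b σ) = cong₂ _+_σ (ℤ-Solver.solve (a ∷ b ∷ [])) (ℤ-Solver.solve (a ∷ b ∷ []))

*ᴱ-distribʳ : _*ᴱ_ DistributesOverʳ _+ᴱ_
*ᴱ-distribʳ (a + b σ) (c + d σ) (e + f σ) =
  cong₂ _+_σ (re-distrib a b c d e f) (im-distrib a b c d e f)
  where
  re-distrib : ∀ a b c d e f → (c + e) * a - (d + f) * b ≡ (c * a - d * b) + (e * a - f * b)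
  re-distrib = ℤ-Solver.solve-∀

  im-distrib : ∀ a b c d e f →
    (c + e) * b + (d + f) * a + (d + f) * b ≡ (c * b + d * a + d * b) + (e * b + f * a + f * b)
  im-distrib = ℤ-Solver.solve-∀

𝔼-isCommutativeRing : IsCommutativeRing _≡_ _+ᴱ_ _*ᴱ_ (-ᴱ_) 0ᴱ 1ᴱ
𝔼-isCommutativeRing = record
  { isRing = record
    { +-isAbelianGroup = record
      { isGroup = record
        { isMonoid = record
          { isSemigroup = record
            { isMagma = record { isEquivalence = isEquivalence ; ∙-cong = cong₂ _+ᴱ_ }
            ; assoc = +ᴱ-assoc }
          ; identity = comm∧idˡ⇒id +ᴱ-comm +ᴱ-identityˡ }
        ; inverse = comm∧invˡ⇒inv +ᴱ-comm +ᴱ-inverseˡ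
        ; ⁻¹-cong = cong (-ᴱ_) }
      ; comm = +ᴱ-comm }
    ; *-cong = cong₂ _*ᴱ_
    ; *-assoc = *ᴱ-assoc
    ; *-identity = comm∧idˡ⇒id *ᴱ-comm *ᴱ-identityˡ
    ; distrib = comm∧distrʳ⇒distrˡ *ᴱ-comm *ᴱ-distribʳ , *ᴱ-distribʳ }
  ; *-comm = *ᴱ-comm }

𝔼-commutativeRing : CommutativeRing _ _
𝔼-commutativeRing = record { isCommutativeRing = 𝔼-isCommutativeRing }

0ᴱ≟_ : ∀ x → Maybe (0ᴱ ≡ x)
0ᴱ≟ (a + b σ) with ℤ.0ℤ ℤ.≟ a | ℤ.0ℤ ℤ.≟ b
... | yes refl | yes refl = just refl
... | _ | _ = nothing

𝔼-almostCommutativeRing : AlmostCommutativeRing _ _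
𝔼-almostCommutativeRing = fromCommutativeRing 𝔼-commutativeRing 0ᴱ≟_

open import Tactic.RingSolver.NonReflective 𝔼-almostCommutativeRing
  using (_⊕_; _⊗_; ⊝_; _⊜_; Κ) renaming (solve to solveᴱ)

det₂ : 𝔼 → 𝔼 → 𝔼 → 𝔼 → 𝔼
det₂ a b c d = a *ᴱ d -ᴱ b *ᴱ c

dot : 𝔼 → 𝔼 → 𝔼 → 𝔼 → 𝔼
dot p q r s = p *ᴱ r +ᴱ q *ᴱ s

det₂-dot : ∀ p q p′ q′ r s r′ s′ →
  det₂ (dot p q r s) (dot p q r′ s′) (dot p′ q′ r s) (dot p′ q′ r′ s′)
    ≡ det₂ p p′ q q′ *ᴱ det₂ r r′ s s′
det₂-dot = solveᴱ 8 (λ p q p′ q′ r s r′ s′ →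
  let det₂ = λ a b c d → a ⊗ d ⊕ ⊝ (b ⊗ c)
      dot = λ p q r s → p ⊗ r ⊕ q ⊗ s
  in det₂ (dot p q r s) (dot p q r′ s′) (dot p′ q′ r s) (dot p′ q′ r′ s′)
       ⊜ det₂ p p′ q q′ ⊗ det₂ r r′ s s′) refl

det3-dot : ∀ p₀ q₀ p₁ q₁ p₂ q₂ r₀ s₀ r₁ s₁ r₂ s₂ →
  det3 (dot p₀ q₀ r₀ s₀) (dot p₀ q₀ r₁ s₁) (dot p₀ q₀ r₂ s₂)
       (dot p₁ q₁ r₀ s₀) (dot p₁ q₁ r₁ s₁) (dot p₁ q₁ r₂ s₂)
       (dot p₂ q₂ r₀ s₀) (dot p₂ q₂ r₁ s₁) (dot p₂ q₂ r₂ s₂) ≡ 0ᴱ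
det3-dot = solveᴱ 12 (λ p₀ q₀ p₁ q₁ p₂ q₂ r₀ s₀ r₁ s₁ r₂ s₂ →
  let det₂ = λ a b c d → a ⊗ d ⊕ ⊝ (b ⊗ c)
      det3 = λ a b c d e f g h k →
        a ⊗ det₂ e f h k ⊕ ⊝ (b ⊗ det₂ d f g k) ⊕ c ⊗ det₂ d e g h
      dot = λ p q r s → p ⊗ r ⊕ q ⊗ s
  in det3 (dot p₀ q₀ r₀ s₀) (dot p₀ q₀ r₁ s₁) (dot p₀ q₀ r₂ s₂)
          (dot p₁ q₁ r₀ s₀) (dot p₁ q₁ r₁ s₁) (dot p₁ q₁ r₂ s₂)
          (dot p₂ q₂ r₀ s₀) (dot p₂ q₂ r₁ s₁) (dot p₂ q₂ r₂ s₂) ⊜ Κ 0ᴱ) refl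

HasUnitConsecutiveMinors : (ℤ → 𝔼) → (ℤ → 𝔼) → Set
HasUnitConsecutiveMinors p q = ∀ i → det₂ (p i) (p (ℤ.suc i)) (q i) (q (ℤ.suc i)) ≡ 1ᴱ

scalarProduct-isSL2Tiling : ∀ p q r s →
  HasUnitConsecutiveMinors p q → HasUnitConsecutiveMinors r s →
  IsSL2Tiling (scalarProduct p q r s)
scalarProduct-isSL2Tiling p q r s det-pq det-rs i j = begin
  det₂ (dot (p i) (q i) (r j) (s j)) (dot (p i) (q i) (r j₁) (s j₁))
       (dot (p i₁) (q i₁) (r j) (s j)) (dot (p i₁) (q i₁) (r j₁) (s j₁))
    ≡⟨ det₂-dot (p i) (q i) (p i₁) (q i₁) (r j) (s j) (r j₁) (s j₁) ⟩
  det₂ (p i) (p i₁) (q i) (q i₁) *ᴱ det₂ (r j) (r j₁) (s j) (s j₁)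
    ≡⟨ cong₂ _*ᴱ_ (det-pq i) (det-rs j) ⟩
  1ᴱ *ᴱ 1ᴱ
    ≡⟨ *ᴱ-identityˡ 1ᴱ ⟩
  1ᴱ ∎
  where
  open ≡-Reasoning
  i₁ j₁ : ℤ
  i₁ = ℤ.suc i
  j₁ = ℤ.suc j

scalarProduct-isTame : ∀ p q r s → IsTame (scalarProduct p q r s)
scalarProduct-isTame p q r s i j =
  det3-dot (p i) (q i) (p i₁) (q i₁) (p i₂) (q i₂) (r j) (s j) (r j₁) (s j₁) (r j₂) (s j₂)
  where
  i₁ i₂ j₁ j₂ : ℤ
  i₁ = ℤ.suc i
  i₂ = ℤ.suc i₁
  j₁ = ℤ.suc j
  j₂ = ℤ.suc j₁

proposition5p8 : (p q r s : ℤ → 𝔼) →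
    NormalisedPath p q → NormalisedPath r s →
    IsSL2Tiling (scalarProduct p q r s) × IsTame (scalarProduct p q r s)
proposition5p8 p q r s (_ , _ , unit-pq) (_ , _ , unit-rs) =
  scalarProduct-isSL2Tiling p q r s unit-pq unit-rs , scalarProduct-isTame p q r s
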